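{- If $(\bm{v},\bm{w})=\mathbf{b}(\mathbf{u})$ for an admissible $\mathbf{u}$, then $|\bm{v}|=|\bm{w}|=\lambda(\mathbf{u})$, where $|\bm{v}|$ denotes the number of $\times$ entries in $\bm{v}$.
   Context: Let $M,N$ be positive integers, $I_{M,N}$ the set of subsets $\Delta\subset\mathbb{Z}_{\ge0}$ with $\Delta+N\subset\Delta$, $\Delta+M\subset\Delta$ and finite complement. For $\mathbf{u}=(u_0,\ldots,u_{N+M-1})\in\{0,1\}^{N+M}$, $\mathbf{u}$ is admissible if some $\Delta\in I_{M,N}$ satisfies $i\in\Delta\Leftrightarrow u_i=1$ for $0\le i<N+M$. $\lambda(\mathbf{u})=\sum_{i=0}^{M-1}(u_{i+N}-u_i)$. $\mathbf{b}(\mathbf{u})=(\bm{v},\bm{w})$ where $\bm{v}\in\{0,\bullet,\times\}^M$ has $v_i=0$ if $u_{N+i}=0$, $v_i=\bullet$ if $u_{N+i}=u_i=1$, $v_i=\times$ if $u_{N+i}=1,u_i=0$; and $\bm{w}\in\{0,\bullet,\times\}^N$ has $w_i=0$ if $u_{M+i}=0$, $w_i=\bullet$ if $u_{M+i}=u_i=1$, $w_i=\times$ if $u_{M+i}=1,u_i=0$. -}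

module Defs where

open import Data.Bool using (Bool; true; false)
open import Data.Nat using (ℕ; zero; suc; _+_; _≤_)
open import Data.Fin using (Fin; toℕ)
import Data.Fin as F
open import Data.Integer using (ℤ; +_; _-_)
import Data.Integer as Z
open import Data.Product using (_×_; _,_; Σ; ∃)
open import Relation.Binary.PropositionalEquality using (_≡_)

Subset : Set
Subset = ℕ → Bool

_∈Δ_ : ℕ → Subset → Set
i ∈Δ Δ = Δ i ≡ true

InI : ℕ → ℕ → Subset → Set
InI M N Δ =
  (∀ i → i ∈Δ Δ → (i + N) ∈Δ Δ) ×
  (∀ i → i ∈Δ Δ → (i + M) ∈Δ Δ) ×
  (∃ λ K → ∀ i → K ≤ i → i ∈Δ Δ)

-- u = (u_0,…,u_{n-1}) ∈ {0,1}^n as a function Fin n → Bool (true = 1).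
-- ix u k = u_k for k < n (default false otherwise; only used in range).
ix : ∀ {n} → (Fin n → Bool) → ℕ → Bool
ix {zero}  u k       = false
ix {suc n} u zero    = u F.zero
ix {suc n} u (suc k) = ix (λ j → u (F.suc j)) k

Admissible : (M N : ℕ) → (Fin (N + M) → Bool) → Set
Admissible M N u = Σ Subset λ Δ → InI M N Δ ×
  (∀ (i : Fin (N + M)) → (toℕ i ∈Δ Δ → u i ≡ true) × (u i ≡ true → toℕ i ∈Δ Δ))

bit : Bool → ℤ
bit true  = + 1
bit false = + 0

sumℤ : ℕ → (ℕ → ℤ) → ℤ
sumℤ zero    f = + 0
sumℤ (suc m) f = sumℤ m f Z.+ f m

lam : (M N : ℕ) → (Fin (N + M) → Bool) → ℤ
lam M N u = sumℤ M (λ i → bit (ix u (i + N)) - bit (ix u i))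

data Sym : Set where
  o     : Sym
  bull  : Sym
  cross : Sym

entry : Bool → Bool → Sym
entry false _     = o
entry true  true  = bull
entry true  false = cross

bvw : (M N : ℕ) → (Fin (N + M) → Bool) → (Fin M → Sym) × (Fin N → Sym)
bvw M N u =
  (λ i → entry (ix u (N + toℕ i)) (ix u (toℕ i))) ,
  (λ i → entry (ix u (M + toℕ i)) (ix u (toℕ i)))

isCross : Sym → ℕ
isCross cross = 1
isCross _     = 0

countCross : ∀ {n} → (Fin n → Sym) → ℕ
countCross {zero}  v = 0
countCross {suc n} v = isCross (v F.zero) + countCross (λ j → v (F.suc j))

-- Admissibility makes u monotone along both shifts: u_i = 1 forces u_{i+N} = 1
-- and u_{i+M} = 1, since Δ is closed under +N and +M. Hence an entry of v or w is
-- × exactly when the shifted bit minus the unshifted one is 1, so |v| and |w| are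
-- the sums Σ_{i<M} (u_{N+i} − u_i) and Σ_{i<N} (u_{M+i} − u_i). The first is λ(u);
-- both sums telescope to Σ_{i<N+M} u_i − Σ_{i<M} u_i − Σ_{i<N} u_i, so they agree.
module Submission where

open import Defs
open import Data.Nat using (ℕ; NonZero; _+_)
open import Data.Fin using (Fin)
open import Data.Bool using (Bool)
open import Data.Integer using (+_)
open import Data.Product using (_×_; proj₁; proj₂)
open import Relation.Binary.PropositionalEquality using (_≡_)

open import Data.Bool using (true; false)
open import Data.Nat using (zero; suc; _<_)
open import Data.Nat.Properties
  using (≤-refl; m<n⇒m<1+n; m+n≤o⇒m≤o; +-comm; +-identityʳ; +-suc; +-monoˡ-<)
open import Data.Fin using (toℕ; fromℕ<)
import Data.Fin as Fin
open import Data.Fin.Properties using (toℕ-fromℕ<)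
open import Data.Integer using (ℤ; _-_)
import Data.Integer as ℤ
import Data.Integer.Properties as ℤ
open import Data.Integer.Solver using (module +-*-Solver)
open import Data.Product using (_,_)
open import Relation.Binary.PropositionalEquality
  using (refl; sym; trans; cong; cong₂; subst; module ≡-Reasoning)

open +-*-Solver

sumℤ-cong : ∀ m {f g : ℕ → ℤ} → (∀ i → i < m → f i ≡ g i) → sumℤ m f ≡ sumℤ m g
sumℤ-cong zero    f≗g = refl
sumℤ-cong (suc m) f≗g =
  cong₂ ℤ._+_ (sumℤ-cong m (λ i i<m → f≗g i (m<n⇒m<1+n i<m))) (f≗g m ≤-refl)

sumℤ-+ : ∀ m n (f : ℕ → ℤ) → sumℤ (m + n) f ≡ sumℤ m f ℤ.+ sumℤ n (λ i → f (m + i))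
sumℤ-+ m zero f rewrite +-identityʳ m =
  solve 1 (λ x → x := x :+ con (+ 0)) refl (sumℤ m f)
sumℤ-+ m (suc n) f rewrite +-suc m n | sumℤ-+ m n f =
  solve 3 (λ x y z → (x :+ y) :+ z := x :+ (y :+ z)) refl
    (sumℤ m f) (sumℤ n (λ i → f (m + i))) (f (m + n))

sumℤ-suc : ∀ m (f : ℕ → ℤ) → sumℤ (suc m) f ≡ f 0 ℤ.+ sumℤ m (λ i → f (suc i))
sumℤ-suc m f = trans (sumℤ-+ 1 m f) (cong (ℤ._+ sumℤ m (λ i → f (suc i))) (ℤ.+-identityˡ (f 0)))

sumℤ-- : ∀ m (f g : ℕ → ℤ) → sumℤ m (λ i → f i - g i) ≡ sumℤ m f - sumℤ m g
sumℤ-- zero    f g = refl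
sumℤ-- (suc m) f g rewrite sumℤ-- m f g =
  solve 4 (λ a b c d → (a :- b) :+ (c :- d) := (a :+ c) :- (b :+ d)) refl
    (sumℤ m f) (sumℤ m g) (f m) (g m)

sumℤ-shift-- : ∀ m n (f : ℕ → ℤ) →
  sumℤ n (λ i → f (m + i) - f i) ≡ sumℤ (m + n) f - sumℤ m f - sumℤ n f
sumℤ-shift-- m n f =
  trans (sumℤ-- n (λ i → f (m + i)) f) (move-left (sumℤ-+ m n f))
  where
  move-left : ∀ {total a s c : ℤ} → total ≡ a ℤ.+ s → s - c ≡ total - a - c
  move-left {a = a} {s} {c} refl =
    solve 3 (λ a s c → s :- c := a :+ s :- a :- c) refl a s c

sumℤ-shift--comm : ∀ m n (f : ℕ → ℤ) →
  sumℤ n (λ i → f (m + i) - f i) ≡ sumℤ m (λ i → f (n + i) - f i)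
sumℤ-shift--comm m n f = begin
  sumℤ n (λ i → f (m + i) - f i)        ≡⟨ sumℤ-shift-- m n f ⟩
  sumℤ (m + n) f - sumℤ m f - sumℤ n f  ≡⟨ cong (λ k → sumℤ k f - sumℤ m f - sumℤ n f) (+-comm m n) ⟩
  sumℤ (n + m) f - sumℤ m f - sumℤ n f  ≡⟨ swap (sumℤ (n + m) f) (sumℤ m f) (sumℤ n f) ⟩
  sumℤ (n + m) f - sumℤ n f - sumℤ m f  ≡⟨ sumℤ-shift-- n m f ⟨
  sumℤ m (λ i → f (n + i) - f i)        ∎
  where
  open ≡-Reasoning
  swap : ∀ a b c → a - b - c ≡ a - c - b
  swap = solve 3 (λ a b c → a :- b :- c := a :- c :- b) refl

countCross-sumℤ : ∀ n (h : ℕ → Sym) →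
  + countCross {n} (λ i → h (toℕ i)) ≡ sumℤ n (λ i → + isCross (h i))
countCross-sumℤ zero    h = refl
countCross-sumℤ (suc n) h =
  trans (cong (ℤ._+_ (+ isCross (h 0))) (countCross-sumℤ n (λ i → h (suc i))))
        (sym (sumℤ-suc n (λ i → + isCross (h i))))

isCross-entry : ∀ a b → (b ≡ true → a ≡ true) → + isCross (entry a b) ≡ bit a - bit b
isCross-entry true  true  b⇒a = refl
isCross-entry true  false b⇒a = refl
isCross-entry false false b⇒a = refl
isCross-entry false true  b⇒a with b⇒a refl
... | ()

countCross-entry : ∀ n (a b : ℕ → Bool) → (∀ i → i < n → b i ≡ true → a i ≡ true) →
  + countCross {n} (λ i → entry (a (toℕ i)) (b (toℕ i))) ≡ sumℤ n (λ i → bit (a i) - bit (b i))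
countCross-entry n a b b⇒a =
  trans (countCross-sumℤ n (λ i → entry (a i) (b i)))
        (sumℤ-cong n (λ i i<n → isCross-entry (a i) (b i) (b⇒a i i<n)))

ix-toℕ : ∀ {n} (u : Fin n → Bool) (i : Fin n) → ix u (toℕ i) ≡ u i
ix-toℕ u Fin.zero    = refl
ix-toℕ u (Fin.suc i) = ix-toℕ (λ j → u (Fin.suc j)) i

ix-fromℕ< : ∀ {n k} (u : Fin n → Bool) (k<n : k < n) → ix u k ≡ u (fromℕ< k<n)
ix-fromℕ< u k<n = trans (cong (ix u) (sym (toℕ-fromℕ< k<n))) (ix-toℕ u (fromℕ< k<n))

Represents : ∀ {n} → (Fin n → Bool) → Subset → Set
Represents u Δ = ∀ i → (toℕ i ∈Δ Δ → u i ≡ true) × (u i ≡ true → toℕ i ∈Δ Δ)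

module _ {n} {u : Fin n → Bool} {Δ : Subset} (u~Δ : Represents u Δ) where

  ix⇒∈Δ : ∀ {k} → k < n → ix u k ≡ true → k ∈Δ Δ
  ix⇒∈Δ k<n uₖ = subst (_∈Δ Δ) (toℕ-fromℕ< k<n)
    (proj₂ (u~Δ (fromℕ< k<n)) (trans (sym (ix-fromℕ< u k<n)) uₖ))

  ∈Δ⇒ix : ∀ {k} → k < n → k ∈Δ Δ → ix u k ≡ true
  ∈Δ⇒ix k<n k∈Δ = trans (ix-fromℕ< u k<n)
    (proj₁ (u~Δ (fromℕ< k<n)) (subst (_∈Δ Δ) (sym (toℕ-fromℕ< k<n)) k∈Δ))

  ix-shift-closed : ∀ s → (∀ i → i ∈Δ Δ → (i + s) ∈Δ Δ) →
    ∀ i → i + s < n → ix u i ≡ true → ix u (i + s) ≡ true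
  ix-shift-closed s closed i i+s<n uᵢ =
    ∈Δ⇒ix i+s<n (closed i (ix⇒∈Δ (m+n≤o⇒m≤o (suc i) i+s<n) uᵢ))

mainTheorem7 : (M N : ℕ) → NonZero M → NonZero N → (u : Fin (N + M) → Bool) →
    Admissible M N u →
      (+ countCross (proj₁ (bvw M N u)) ≡ lam M N u) ×
      (+ countCross (proj₂ (bvw M N u)) ≡ lam M N u)
mainTheorem7 M N _ _ u (Δ , (+N-closed , +M-closed , _) , u~Δ) = |v|≡λ , |w|≡λ
  where
  f : ℕ → ℤ
  f k = bit (ix u k)

  N-shift : ∀ i → i < M → ix u i ≡ true → ix u (N + i) ≡ true
  N-shift i i<M uᵢ = subst (λ k → ix u k ≡ true) (+-comm i N)
    (ix-shift-closed u~Δ N +N-closed i (subst (i + N <_) (+-comm M N) (+-monoˡ-< N i<M)) uᵢ)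

  M-shift : ∀ i → i < N → ix u i ≡ true → ix u (M + i) ≡ true
  M-shift i i<N uᵢ = subst (λ k → ix u k ≡ true) (+-comm i M)
    (ix-shift-closed u~Δ M +M-closed i (+-monoˡ-< M i<N) uᵢ)

  λ-as-sum : sumℤ M (λ i → f (N + i) - f i) ≡ lam M N u
  λ-as-sum = sumℤ-cong M (λ i _ → cong (λ k → f k - f i) (+-comm N i))

  |v|≡λ : + countCross (proj₁ (bvw M N u)) ≡ lam M N u
  |v|≡λ = trans (countCross-entry M (λ i → ix u (N + i)) (ix u) N-shift) λ-as-sum

  |w|≡λ : + countCross (proj₂ (bvw M N u)) ≡ lam M N u
  |w|≡λ = trans (countCross-entry N (λ i → ix u (M + i)) (ix u) M-shift)
            (trans (sumℤ-shift--comm M N f) λ-as-sum)
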